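{- Let $\Gamma$ be a simple binary sequent and let $\phi$ be its unique axiom-link involution. If the strategy $\sigma_\Gamma=\sigma_{(\Gamma,\phi)}$ is winning for $\Gamma$, then the proof structure $(\Gamma,\phi)$ is acyclic, i.e. its graph (formation trees of the formulas of $\Gamma$ together with an edge between each literal occurrence $i$ and $\phi(i)$) contains no cycle.
   Context: Games $A=(M_A,\lambda_A,P_A,W_A)$ ($\lambda_A:M_A\to\{P,O\}$; $P_A$ a nonempty prefix-closed set of finite alternately labelled sequences; $W_A$ a set of infinite sequences with all prefixes in $P_A$). Strategies: nonempty prefix-closed $\sigma\subseteq P_A$, nonempty elements starting with an $O$-move, deterministic at odd-length positions, closed under extensions in $P_A$ at even-length positions; winning if they beat every counter-strategy (finite plays lost by the player to move; infinite plays won by Player iff in $W_A$). For partial $f:M^-_A\rightharpoonup M^+_A$, $\sigma_f$ plays $f(a)$ at a Player-to-move position $s\cdot a$ if defined and $s\cdot a\cdot f(a)\in P_A$, and has no response otherwise. $A^\perp$ swaps labels and complements $W_A$ among infinite plays; $A\otimes B$: moves $M_A+M_B$, positions alternately labelled sequences whose projections are positions of $A$ and $B$ and in which whenever two successive moves lie in different components the second is an $O$-move; winning infinite plays those whose projection on each component is finite or winning; $A⅋B=(A^\perp\otimes B^\perp)^\perp$. An MLL sequent $\Gamma$ is a list of formulas built from literals $\alpha,\alpha^\perp$ by $\otimes,⅋$; atoms $\alpha_1..\alpha_k$, literal occurrences $c_1..c_n$ with $c_i$ an occurrence of $l_i\in\{\alpha_{j_i},\alpha_{j_i}^\perp\}$.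 For games $\vec A$, $F_\Gamma(\vec A)$ interprets $\alpha_j$ as $A_j$, $\alpha_j^\perp$ as $A_j^\perp$ and the sequent as the $⅋$ of its formulas; moves $\bigcup_i\{i\}\times M_{C_i}$, $C_i=A_{j_i}$ or $A_{j_i}^\perp$. A binary sequent has each atom occurring exactly once positively and once negatively, so it has a unique fixpoint-free involution $\phi$ on occurrences with $l_{\phi(i)}=l_i^\perp$; it is simple if every formula is a literal or a tensor of two literals. $\sigma_{(\Gamma,\phi)}$ is the family $\{\sigma_{f_{\vec A}}\}$, $f_{\vec A}((i,a))=(\phi(i),a)$ for $O$-moves $a$ of $C_i$; it is winning for $\Gamma$ if each $\sigma_{f_{\vec A}}$ is a winning strategy in $F_\Gamma(\vec A)$, for all $k$-tuples of games $\vec A$. -}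

module Defs where

open import Data.Nat using (ℕ; zero; suc; _<_; _≤_; _%_)
open import Data.Fin using (Fin)
open import Data.List using (List; []; _∷_; _++_; _∷ʳ_; map; length; applyUpTo)
open import Data.List.Relation.Unary.All using (All)
open import Data.List.Relation.Unary.Unique.Propositional using (Unique)
open import Data.Maybe using (Maybe; just; nothing)
open import Data.Sum using (_⊎_; inj₁; inj₂)
open import Data.Product using (Σ; _×_; _,_)
open import Data.Unit using (⊤)
open import Data.Empty using (⊥)
open import Relation.Nullary using (¬_)
open import Relation.Binary.PropositionalEquality using (_≡_; refl)

data Pol : Set where
  Opp Pla : Pol

flipPol : Pol → Pol
flipPol Opp = Pla
flipPol Pla = Opp

Even : ℕ → Set
Even n = n % 2 ≡ 0

Odd : ℕ → Set
Odd n = n % 2 ≡ 1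

-- Games  A = (M_A, λ_A, P_A, W_A)
-- Positions are finite lists in chronological order; infinite sequences
-- are functions ℕ → M; 'pre g n' is the prefix of length n of g.

record Game : Set₁ where
  field
    M   : Set
    lab : M → Pol
    P   : List M → Set
    W   : (ℕ → M) → Set
open Game public

pre : {X : Set} → (ℕ → X) → ℕ → List X
pre g n = applyUpTo g n

Alternating : {X : Set} → (X → Pol) → List X → Set
Alternating l []           = ⊤
Alternating l (x ∷ [])     = ⊤
Alternating l (x ∷ y ∷ s)  = ¬ (l x ≡ l y) × Alternating l (y ∷ s)

record IsGame (A : Game) : Set where
  field
    P-nonempty   : P A []
    P-prefix     : ∀ s t → P A (s ++ t) → P A s
    P-alternating : ∀ s → P A s → Alternating (lab A) s
    W-plays      : ∀ g → W A g → ∀ n → P A (pre g n)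

record IsStrategy (A : Game) (σ : List (M A) → Set) : Set where
  field
    nonempty  : σ []
    prefix    : ∀ s t → σ (s ++ t) → σ s
    positions : ∀ s → σ s → P A s
    O-start   : ∀ a s → σ (a ∷ s) → lab A a ≡ Opp
    det-odd   : ∀ s a b → Odd (length s) → σ (s ∷ʳ a) → σ (s ∷ʳ b) → a ≡ b
    closed-even : ∀ s a → Even (length s) → σ s → lab A a ≡ Opp →
                  P A (s ∷ʳ a) → σ (s ∷ʳ a)

record IsCounterStrategy (A : Game) (τ : List (M A) → Set) : Set where
  field
    nonempty  : τ []
    prefix    : ∀ s t → τ (s ++ t) → τ s
    positions : ∀ s → τ s → P A s
    O-start   : ∀ a s → τ (a ∷ s) → lab A a ≡ Opp
    det-even  : ∀ s a b → Even (length s) → τ (s ∷ʳ a) → τ (s ∷ʳ b) → a ≡ b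
    closed-odd : ∀ s a → Odd (length s) → τ s → P A (s ∷ʳ a) → τ (s ∷ʳ a)

-- σ beats every counter-strategy τ: the play σ ∩ τ is won by Player.
-- If it is finite, its last position is maximal in σ ∩ τ and Player wins
-- iff Opponent is to move there (even length); if it is infinite, each
-- infinite sequence all of whose prefixes lie in σ ∩ τ must be in W_A.
Winning : (A : Game) → (List (M A) → Set) → Set₁
Winning A σ =
  ∀ (τ : List (M A) → Set) → IsCounterStrategy A τ →
    (∀ s → σ s → τ s → (∀ a → σ (s ∷ʳ a) → τ (s ∷ʳ a) → ⊥) → Even (length s))
    × (∀ (g : ℕ → M A) → (∀ n → σ (pre g n) × τ (pre g n)) → W A g)

IsWinningStrategy : (A : Game) → (List (M A) → Set) → Set₁
IsWinningStrategy A σ = IsStrategy A σ × Winning A σ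

data σ[_,_] (A : Game) (f : M A → Maybe (M A)) : List (M A) → Set where
  nil   : σ[ A , f ] []
  omove : ∀ {s a} → σ[ A , f ] s → Even (length s) → lab A a ≡ Opp →
          P A (s ∷ʳ a) → σ[ A , f ] (s ∷ʳ a)
  pmove : ∀ {s a b} → σ[ A , f ] (s ∷ʳ a) → Odd (length (s ∷ʳ a)) →
          f a ≡ just b → P A (s ∷ʳ a ∷ʳ b) → σ[ A , f ] (s ∷ʳ a ∷ʳ b)

_^⊥ : Game → Game
M   (A ^⊥) = M A
lab (A ^⊥) a = flipPol (lab A a)
P   (A ^⊥) = P A
W   (A ^⊥) g = (∀ n → P A (pre g n)) × ¬ W A g

projL : {X Y : Set} → List (X ⊎ Y) → List X
projL []           = []
projL (inj₁ x ∷ s) = x ∷ projL s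
projL (inj₂ y ∷ s) = projL s

projR : {X Y : Set} → List (X ⊎ Y) → List Y
projR []           = []
projR (inj₁ x ∷ s) = projR s
projR (inj₂ y ∷ s) = y ∷ projR s

DiffComp : {X Y : Set} → X ⊎ Y → X ⊎ Y → Set
DiffComp (inj₁ _) (inj₁ _) = ⊥
DiffComp (inj₁ _) (inj₂ _) = ⊤
DiffComp (inj₂ _) (inj₁ _) = ⊤
DiffComp (inj₂ _) (inj₂ _) = ⊥

SwitchO : {X Y : Set} → (X ⊎ Y → Pol) → List (X ⊎ Y) → Set
SwitchO l []          = ⊤
SwitchO l (x ∷ [])    = ⊤
SwitchO l (x ∷ y ∷ s) = (DiffComp x y → l y ≡ Opp) × SwitchO l (y ∷ s)

labSum : (A B : Game) → M A ⊎ M B → Pol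
labSum A B (inj₁ a) = lab A a
labSum A B (inj₂ b) = lab B b

-- h is the (infinite) projection of g on the left/right component
IsProjL : {X Y : Set} → (ℕ → X ⊎ Y) → (ℕ → X) → Set
IsProjL {X} g h = Σ (ℕ → ℕ) λ e → (∀ n → e n < e (suc n))
  × (∀ n → g (e n) ≡ inj₁ (h n))
  × (∀ m (x : X) → g m ≡ inj₁ x → Σ ℕ λ n → e n ≡ m)

IsProjR : {X Y : Set} → (ℕ → X ⊎ Y) → (ℕ → Y) → Set
IsProjR {Y = Y} g h = Σ (ℕ → ℕ) λ e → (∀ n → e n < e (suc n))
  × (∀ n → g (e n) ≡ inj₂ (h n))
  × (∀ m (y : Y) → g m ≡ inj₂ y → Σ ℕ λ n → e n ≡ m)

_⊗_ : Game → Game → Game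
M   (A ⊗ B) = M A ⊎ M B
lab (A ⊗ B) = labSum A B
P   (A ⊗ B) s = Alternating (labSum A B) s × P A (projL s) × P B (projR s)
                × SwitchO (labSum A B) s
W   (A ⊗ B) g =
  (∀ n → P (A ⊗ B) (pre g n))
  × (∀ h → IsProjL g h → W A h)     -- left projection finite or winning
  × (∀ h → IsProjR g h → W B h)     -- right projection finite or winning

_⅋_ : Game → Game → Game
A ⅋ B = ((A ^⊥) ⊗ (B ^⊥)) ^⊥

-- unit for ⅋ (only used for the empty sequent)
⊥game : Game
M   ⊥game = ⊥
lab ⊥game ()
P   ⊥game s = s ≡ []
W   ⊥game g = ⊥

relabel : (G : Game) (N : Set) → (N → M G) → Game
M   (relabel G N to) = N
lab (relabel G N to) n = lab G (to n)
P   (relabel G N to) s = P G (map to s)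
W   (relabel G N to) g = W G (λ n → to (g n))

data Lit (k : ℕ) : Set where
  pos : Fin k → Lit k
  neg : Fin k → Lit k

dualLit : ∀ {k} → Lit k → Lit k
dualLit (pos j) = neg j
dualLit (neg j) = pos j

data Conn : Set where
  tens par : Conn

data Formula (k : ℕ) : Set where
  lit : Lit k → Formula k
  bin : Conn → Formula k → Formula k → Formula k

Sequent : ℕ → Set
Sequent k = List (Formula k)

data Occ {k} : Formula k → Set where
  here  : (l : Lit k) → Occ (lit l)
  left  : ∀ {c A B} → Occ A → Occ (bin c A B)
  right : ∀ {c A B} → Occ B → Occ (bin c A B)

litOf : ∀ {k} {F : Formula k} → Occ F → Lit k
litOf (here l)  = l
litOf (left o)  = litOf o
litOf (right o) = litOf o

data SOcc {k} : Sequent k → Set where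
  hd : ∀ {F Γ} → Occ F → SOcc (F ∷ Γ)
  tl : ∀ {F Γ} → SOcc Γ → SOcc (F ∷ Γ)

litS : ∀ {k} {Γ : Sequent k} → SOcc Γ → Lit k
litS (hd o) = litOf o
litS (tl o) = litS o

Binary : ∀ {k} → Sequent k → Set
Binary {k} Γ = ∀ (l : Lit k) →
  Σ (SOcc Γ) λ o → litS o ≡ l × (∀ o' → litS o' ≡ l → o' ≡ o)

data IsSimpleFormula {k} : Formula k → Set where
  isLit  : ∀ l → IsSimpleFormula (lit l)
  isTens : ∀ l l' → IsSimpleFormula (bin tens (lit l) (lit l'))

Simple : ∀ {k} → Sequent k → Set
Simple Γ = All IsSimpleFormula Γ

record IsAxiomLinking {k} (Γ : Sequent k) (φ : SOcc Γ → SOcc Γ) : Set where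
  field
    involutive : ∀ o → φ (φ o) ≡ o
    fixpoint-free : ∀ o → ¬ (φ o ≡ o)
    dual-lits : ∀ o → litS (φ o) ≡ dualLit (litS o)

data Node {k} : Formula k → Set where
  root  : ∀ {F} → Node F
  left  : ∀ {c A B} → Node A → Node (bin c A B)
  right : ∀ {c A B} → Node B → Node (bin c A B)

occNode : ∀ {k} {F : Formula k} → Occ F → Node F
occNode (here l)  = root
occNode (left o)  = left (occNode o)
occNode (right o) = right (occNode o)

data TreeEdge {k} : {F : Formula k} → Node F → Node F → Set where
  toLeft  : ∀ {c A B} → TreeEdge {F = bin c A B} root (left root)
  toRight : ∀ {c A B} → TreeEdge {F = bin c A B} root (right root)
  inLeft  : ∀ {c A B} {u v : Node A} → TreeEdge u v →
            TreeEdge {F = bin c A B} (left u) (left v)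
  inRight : ∀ {c A B} {u v : Node B} → TreeEdge u v →
            TreeEdge {F = bin c A B} (right u) (right v)

data SNode {k} : Sequent k → Set where
  hd : ∀ {F Γ} → Node F → SNode (F ∷ Γ)
  tl : ∀ {F Γ} → SNode Γ → SNode (F ∷ Γ)

leafS : ∀ {k} {Γ : Sequent k} → SOcc Γ → SNode Γ
leafS (hd o) = hd (occNode o)
leafS (tl o) = tl (leafS o)

data STreeEdge {k} : {Γ : Sequent k} → SNode Γ → SNode Γ → Set where
  hd : ∀ {F Γ} {u v : Node F} → TreeEdge u v → STreeEdge {Γ = F ∷ Γ} (hd u) (hd v)
  tl : ∀ {F Γ} {u v : SNode Γ} → STreeEdge u v → STreeEdge {Γ = F ∷ Γ} (tl u) (tl v)

Adj : ∀ {k} (Γ : Sequent k) → (SOcc Γ → SOcc Γ) → SNode Γ → SNode Γ → Set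
Adj Γ φ v w = STreeEdge v w ⊎ STreeEdge w v
              ⊎ Σ (SOcc Γ) λ o → v ≡ leafS o × w ≡ leafS (φ o)

Chain : {V : Set} → (V → V → Set) → List V → Set
Chain R []          = ⊤
Chain R (x ∷ [])    = ⊤
Chain R (x ∷ y ∷ s) = R x y × Chain R (y ∷ s)

HasCycle : {V : Set} → (V → V → Set) → Set
HasCycle {V} R = Σ V λ v → Σ (List V) λ vs →
  2 ≤ length vs × Unique (v ∷ vs) × Chain R ((v ∷ vs) ∷ʳ v)

Acyclic : ∀ {k} (Γ : Sequent k) → (SOcc Γ → SOcc Γ) → Set
Acyclic Γ φ = ¬ HasCycle (Adj Γ φ)

module _ {k : ℕ} (A : Fin k → Game) where

  litGame : Lit k → Game
  litGame (pos j) = A j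
  litGame (neg j) = A j ^⊥

  ⟦_⟧F : Formula k → Game
  ⟦ lit l ⟧F         = litGame l
  ⟦ bin tens F G ⟧F  = ⟦ F ⟧F ⊗ ⟦ G ⟧F
  ⟦ bin par  F G ⟧F  = ⟦ F ⟧F ⅋ ⟦ G ⟧F

  ⟦_⟧S : Sequent k → Game
  ⟦ [] ⟧S          = ⊥game
  ⟦ F ∷ [] ⟧S      = ⟦ F ⟧F
  ⟦ F ∷ G ∷ Γ ⟧S   = ⟦ F ⟧F ⅋ ⟦ G ∷ Γ ⟧S

  injF : {F : Formula k} (o : Occ F) → M (litGame (litOf o)) → M ⟦ F ⟧F
  injF (here l) a = a
  injF {bin tens _ _} (left o)  a = inj₁ (injF o a)
  injF {bin par  _ _} (left o)  a = inj₁ (injF o a)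
  injF {bin tens _ _} (right o) a = inj₂ (injF o a)
  injF {bin par  _ _} (right o) a = inj₂ (injF o a)

  injS : {Γ : Sequent k} (o : SOcc Γ) → M (litGame (litS o)) → M ⟦ Γ ⟧S
  injS {F ∷ []}    (hd o) a = injF o a
  injS {F ∷ G ∷ Γ} (hd o) a = inj₁ (injF o a)
  injS {F ∷ G ∷ Γ} (tl o) a = inj₂ (injS o a)

  SMove : Sequent k → Set
  SMove Γ = Σ (SOcc Γ) λ o → M (litGame (litS o))

  F[_] : Sequent k → Game
  F[ Γ ] = relabel ⟦ Γ ⟧S (SMove Γ) (λ { (o , a) → injS o a })

  dualMove : (l l' : Lit k) → l' ≡ dualLit l → M (litGame l) → M (litGame l')
  dualMove (pos j) _ refl a = a
  dualMove (neg j) _ refl a = a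

  fφ : (Γ : Sequent k) (φ : SOcc Γ → SOcc Γ) →
       (∀ o → litS (φ o) ≡ dualLit (litS o)) → SMove Γ → Maybe (SMove Γ)
  fφ Γ φ h (o , a) with lab (litGame (litS o)) a
  ... | Opp = just (φ o , dualMove (litS o) (litS (φ o)) (h o) a)
  ... | Pla = nothing

WinningFor : ∀ {k} (Γ : Sequent k) (φ : SOcc Γ → SOcc Γ) →
             (∀ o → litS (φ o) ≡ dualLit (litS o)) → Set₁
WinningFor {k} Γ φ h =
  ∀ (A : Fin k → Game) → (∀ j → IsGame (A j)) →
    IsWinningStrategy (F[_] A Γ) σ[ F[_] A Γ , fφ A Γ φ h ]

module Submission where

-- Interpret every atom by a game with a single move. In a simple sequent a literal formula
-- is an isolated leaf and a tensor root is adjacent only to its two leaves, so a cycle of the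
-- proof structure runs leaf o, axiom link, tensor leaf φ o, tensor root, sibling of φ o, axiom
-- link, … Opponent follows it: he opens in u₀, σ copies the move to φ u₀, he answers in the
-- sibling u₁ of φ u₀, and so on, each round entering a fresh formula. As there are finitely
-- many formulas, some copy eventually lands in a formula already played in; there it is
-- illegal (a second move in a one-move game, or a Player switch inside a tensor), so σ has no
-- reply at an odd position and loses.

open import Defs
open import Data.Empty using (⊥; ⊥-elim)
open import Data.Fin as Fin using (Fin)
import Data.Fin.Properties as Finₚ
open import Data.List using (List; []; _∷_; _++_; _∷ʳ_; map; length; initLast; _∷ʳ′_)
open import Data.List.Membership.Propositional using (_∈_; lose)
open import Data.List.Membership.Propositional.Properties using (∈-++⁺ˡ; ∈-++⁺ʳ; ∈-map⁺)
open import Data.List.Properties using (∷ʳ-injective; map-++; ++-assoc; ++-identityʳ)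
open import Data.List.Relation.Unary.All as All using (All; []; _∷_)
open import Data.List.Relation.Unary.All.Properties using (∷ʳ⁺)
open import Data.List.Relation.Unary.AllPairs using (_∷_)
open import Data.List.Relation.Unary.Any using (Any; here; there)
open import Data.List.Relation.Unary.Unique.Propositional using (Unique)
open import Data.Maybe using (Maybe; just)
open import Data.Maybe.Properties using (just-injective)
open import Data.Nat using (ℕ; zero; suc; _<_; _≤_; z≤n; s≤s)
open import Data.Nat.Properties
  using (suc-injective; ≤-refl; <⇒≤; ≤-trans; ≤-pred; m≤n⇒m≤1+n; m≤n⇒m<n∨m≡n; anyUpTo?)
open import Data.Product using (Σ; ∃; _×_; _,_; proj₁; proj₂)
open import Data.Sum using (_⊎_; inj₁; inj₂)
open import Data.Unit using (⊤; tt)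
open import Function using (_∘_)
open import Relation.Binary.PropositionalEquality using (_≡_; _≢_; refl; sym; trans; cong; subst)
open import Relation.Nullary using (¬_; yes; no)
open import Relation.Unary using (Decidable)

private variable
  X Y : Set

OnLast : (X → Set) → List X → Set
OnLast Q []          = ⊤
OnLast Q (x ∷ [])    = Q x
OnLast Q (x ∷ y ∷ s) = OnLast Q (y ∷ s)

OnLast-∷ʳ : {Q : X → Set} (s : List X) {x : X} → Q x → OnLast Q (s ∷ʳ x)
OnLast-∷ʳ []          q = q
OnLast-∷ʳ (y ∷ [])    q = q
OnLast-∷ʳ (y ∷ z ∷ s) q = OnLast-∷ʳ (z ∷ s) q

OnLast-map : {Q R : X → Set} → (∀ {y} → Q y → R y) → (s : List X) → OnLast Q s → OnLast R s
OnLast-map f []          q = tt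
OnLast-map f (y ∷ [])    q = f q
OnLast-map f (y ∷ z ∷ s) q = OnLast-map f (z ∷ s) q

OnLast-universal : {Q : X → Set} → (∀ y → Q y) → (s : List X) → OnLast Q s
OnLast-universal f []          = tt
OnLast-universal f (y ∷ [])    = f y
OnLast-universal f (y ∷ z ∷ s) = OnLast-universal f (z ∷ s)

Alternating-∷ʳ : (l : X → Pol) (s : List X) {x : X} → Alternating l s →
                 OnLast (λ y → l y ≢ l x) s → Alternating l (s ∷ʳ x)
Alternating-∷ʳ l []          _       _ = tt
Alternating-∷ʳ l (y ∷ [])    _       q = q , tt
Alternating-∷ʳ l (y ∷ z ∷ s) (n , a) q = n , Alternating-∷ʳ l (z ∷ s) a q

SwitchO-∷ʳ : (l : X ⊎ Y → Pol) (s : List (X ⊎ Y)) {x : X ⊎ Y} → SwitchO l s →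
             OnLast (λ y → DiffComp y x → l x ≡ Opp) s → SwitchO l (s ∷ʳ x)
SwitchO-∷ʳ l []          _       _ = tt
SwitchO-∷ʳ l (y ∷ [])    _       q = q , tt
SwitchO-∷ʳ l (y ∷ z ∷ s) (n , a) q = n , SwitchO-∷ʳ l (z ∷ s) a q

SwitchO-∷ʳ⁻ : (l : X ⊎ Y → Pol) (s : List (X ⊎ Y)) {y x : X ⊎ Y} →
              SwitchO l (s ∷ʳ y ∷ʳ x) → DiffComp y x → l x ≡ Opp
SwitchO-∷ʳ⁻ l []          (q , _)     = q
SwitchO-∷ʳ⁻ l (z ∷ [])    (_ , q , _) = q
SwitchO-∷ʳ⁻ l (z ∷ w ∷ s) (_ , a)     = SwitchO-∷ʳ⁻ l (w ∷ s) a

projL-∷ʳ₁ : (s : List (X ⊎ Y)) (x : X) → projL (s ∷ʳ inj₁ x) ≡ projL s ∷ʳ x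
projL-∷ʳ₁ []           x = refl
projL-∷ʳ₁ (inj₁ z ∷ s) x = cong (z ∷_) (projL-∷ʳ₁ s x)
projL-∷ʳ₁ (inj₂ z ∷ s) x = projL-∷ʳ₁ s x

projL-∷ʳ₂ : (s : List (X ⊎ Y)) (y : Y) → projL (s ∷ʳ inj₂ y) ≡ projL s
projL-∷ʳ₂ []           y = refl
projL-∷ʳ₂ (inj₁ z ∷ s) y = cong (z ∷_) (projL-∷ʳ₂ s y)
projL-∷ʳ₂ (inj₂ z ∷ s) y = projL-∷ʳ₂ s y

projR-∷ʳ₁ : (s : List (X ⊎ Y)) (x : X) → projR (s ∷ʳ inj₁ x) ≡ projR s
projR-∷ʳ₁ []           x = refl
projR-∷ʳ₁ (inj₁ z ∷ s) x = projR-∷ʳ₁ s x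
projR-∷ʳ₁ (inj₂ z ∷ s) x = cong (z ∷_) (projR-∷ʳ₁ s x)

projR-∷ʳ₂ : (s : List (X ⊎ Y)) (y : Y) → projR (s ∷ʳ inj₂ y) ≡ projR s ∷ʳ y
projR-∷ʳ₂ []           y = refl
projR-∷ʳ₂ (inj₁ z ∷ s) y = projR-∷ʳ₂ s y
projR-∷ʳ₂ (inj₂ z ∷ s) y = cong (z ∷_) (projR-∷ʳ₂ s y)

projL-∷ʳ₁₁ : (s : List (X ⊎ Y)) (x y : X) → projL (s ∷ʳ inj₁ x ∷ʳ inj₁ y) ≡ projL s ∷ʳ x ∷ʳ y
projL-∷ʳ₁₁ s x y = trans (projL-∷ʳ₁ (s ∷ʳ inj₁ x) y) (cong (_∷ʳ y) (projL-∷ʳ₁ s x))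

projR-∷ʳ₁₁ : (s : List (X ⊎ Y)) (x y : X) → projR (s ∷ʳ inj₁ x ∷ʳ inj₁ y) ≡ projR s
projR-∷ʳ₁₁ s x y = trans (projR-∷ʳ₁ (s ∷ʳ inj₁ x) y) (projR-∷ʳ₁ s x)

projL-∷ʳ₂₂ : (s : List (X ⊎ Y)) (x y : Y) → projL (s ∷ʳ inj₂ x ∷ʳ inj₂ y) ≡ projL s
projL-∷ʳ₂₂ s x y = trans (projL-∷ʳ₂ (s ∷ʳ inj₂ x) y) (projL-∷ʳ₂ s x)

projR-∷ʳ₂₂ : (s : List (X ⊎ Y)) (x y : Y) → projR (s ∷ʳ inj₂ x ∷ʳ inj₂ y) ≡ projR s ∷ʳ x ∷ʳ y
projR-∷ʳ₂₂ s x y = trans (projR-∷ʳ₂ (s ∷ʳ inj₂ x) y) (cong (_∷ʳ y) (projR-∷ʳ₂ s x))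

length-∷ʳ : (s : List X) (x : X) → length (s ∷ʳ x) ≡ suc (length s)
length-∷ʳ []      x = refl
length-∷ʳ (y ∷ s) x = cong suc (length-∷ʳ s x)

map-∷ʳ : (g : X → Y) (s : List X) (x : X) → map g (s ∷ʳ x) ≡ map g s ∷ʳ g x
map-∷ʳ g s x = map-++ g s (x ∷ [])

∷ʳ²-long : (t : List X) (y x : X) → ¬ length (t ∷ʳ y ∷ʳ x) ≤ 1
∷ʳ²-long t y x le with subst (_≤ 1) (trans (length-∷ʳ (t ∷ʳ y) x) (cong suc (length-∷ʳ t y))) le
... | s≤s ()

∷ʳ≢[] : (s : List X) {x : X} → s ∷ʳ x ≢ []
∷ʳ≢[] []      ()
∷ʳ≢[] (y ∷ s) ()

Pla≢Opp : Pla ≢ Opp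
Pla≢Opp ()

flipPol-involutive : ∀ p → flipPol (flipPol p) ≡ p
flipPol-involutive Opp = refl
flipPol-involutive Pla = refl

any⇒≢[] : {Q : X → Set} {s : List X} → Any Q s → s ≢ []
any⇒≢[] (here _)  ()
any⇒≢[] (there _) ()

nonempty⇒∷ʳ : (s : List X) → s ≢ [] → ∃ λ t → ∃ λ y → s ≡ t ∷ʳ y
nonempty⇒∷ʳ s s≢[] with initLast s
... | []      = ⊥-elim (s≢[] refl)
... | t ∷ʳ′ y = t , y , refl

Repeats : (ℕ → X) → ℕ → Set
Repeats a n = ∃ λ i → i < n × a i ≡ a n

least-witness : {Q : ℕ → Set} → Decidable Q → ∀ bound {n} → n ≤ bound → Q n →
  ∃ λ m → Q m × (∀ {i} → i < m → ¬ Q i)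
least-witness Q? zero    z≤n q = 0 , q , λ ()
least-witness Q? (suc b) {n} n≤ q with anyUpTo? Q? n
... | no none             = n , q , λ i<n qi → none (_ , i<n , qi)
... | yes (m , m<n , q′)  = least-witness Q? b (≤-pred (≤-trans m<n n≤)) q′

Repeats? : ∀ {N} (a : ℕ → Fin N) → Decidable (Repeats a)
Repeats? a n = anyUpTo? (λ i → a i Fin.≟ a n) n

firstRepetition : ∀ {N} (a : ℕ → Fin N) → ∃ λ n → Repeats a (suc n) × (∀ {m} → m ≤ n → ¬ Repeats a m)
firstRepetition a with Finₚ.pigeonhole ≤-refl (a ∘ Fin.toℕ)
... | i , j , i<j , eq with least-witness (Repeats? a) (Fin.toℕ j) ≤-refl (Fin.toℕ i , i<j , eq)
...   | zero  , (_ , () , _) , _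
...   | suc n , repeats , earlier = n , repeats , λ m≤n → earlier (s≤s m≤n)

module _ {V : Set} (R : V → V → Set) where

  TwoNeighboursIn : List V → V → Set
  TwoNeighboursIn L x = ∃ λ y → ∃ λ z → y ∈ L × z ∈ L × y ≢ z × R x y × R x z

  twoNeighbours-among : ∀ {L x a b} {B : Set} → TwoNeighboursIn L x →
    (∀ {y} → R x y → y ≡ a ⊎ (B × y ≡ b)) → a ∈ L × B × b ∈ L
  twoNeighbours-among (y , z , y∈ , z∈ , y≢z , x-y , x-z) among with among x-y | among x-z
  ... | inj₁ refl       | inj₁ refl       = ⊥-elim (y≢z refl)
  ... | inj₁ refl       | inj₂ (β , refl) = y∈ , β , z∈
  ... | inj₂ (β , refl) | inj₁ refl       = z∈ , β , y∈
  ... | inj₂ (_ , refl) | inj₂ (_ , refl) = ⊥-elim (y≢z refl)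

module _ {V : Set} {R : V → V → Set} (R-sym : ∀ {x y} → R x y → R y x) where

  private
    inner-twoNeighbours : ∀ L prev l e → Chain R (prev ∷ (l ∷ʳ e)) → Unique l →
      All (prev ≢_) l → All (e ≢_) l → prev ≢ e ⊎ 2 ≤ length l →
      prev ∈ L → e ∈ L → All (_∈ L) l → ∀ {x} → x ∈ l → TwoNeighboursIn R L x
    inner-twoNeighbours L prev (x ∷ []) e (prev-x , x-e , _) _ _ _ prev≢e⊎long prev∈ e∈ _ (here refl)
      with prev≢e⊎long
    ... | inj₁ prev≢e = prev , e , prev∈ , e∈ , prev≢e , R-sym prev-x , x-e
    ... | inj₂ (s≤s ())
    inner-twoNeighbours L prev (x ∷ y ∷ l) e (prev-x , x-y , _) _ (_ ∷ prev≢y ∷ _) _ _ prev∈ _ (_ ∷ y∈ ∷ _)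
                        (here refl) =
      prev , y , prev∈ , y∈ , prev≢y , R-sym prev-x , x-y
    inner-twoNeighbours L prev (x ∷ y ∷ l) e (_ , chain) (x∉ ∷ unique) _ (e≢x ∷ e∉) _ _ e∈ (x∈ ∷ l⊆) (there i) =
      inner-twoNeighbours L x (y ∷ l) e chain unique x∉ e∉ (inj₁ (e≢x ∘ sym)) x∈ e∈ l⊆ i

    last-edge : ∀ a l e → Chain R (a ∷ (l ∷ʳ e)) → l ≢ [] → ∃ λ w → w ∈ l × R w e
    last-edge a []          e _           l≢[] = ⊥-elim (l≢[] refl)
    last-edge a (x ∷ [])    e (_ , x-e , _) _  = x , here refl , x-e
    last-edge a (x ∷ y ∷ l) e (_ , chain)   _ with last-edge x (y ∷ l) e chain (λ ())
    ... | w , w∈ , w-e = w , there w∈ , w-e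

  cycle-twoNeighbours : HasCycle R → ∃ λ L → (∃ λ v → v ∈ L) × (∀ {x} → x ∈ L → TwoNeighboursIn R L x)
  cycle-twoNeighbours (v , []         , ()     , _)
  cycle-twoNeighbours (v , _ ∷ []     , s≤s () , _)
  cycle-twoNeighbours (v , v₁ ∷ v₂ ∷ vs , 2≤ , (v∉ ∷ unique@(v₁∉ ∷ _)) , v-v₁ , chain) =
    L , (v , here refl) , neighbours
    where
    L : List V
    L = v ∷ v₁ ∷ v₂ ∷ vs
    neighbours : ∀ {x} → x ∈ L → TwoNeighboursIn R L x
    neighbours (here refl) with last-edge v₁ (v₂ ∷ vs) v chain (λ ())
    ... | w , w∈ , w-v = v₁ , w , there (here refl) , there (there w∈) , All.lookup v₁∉ w∈ , v-v₁ , R-sym w-v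
    neighbours (there x∈) =
      inner-twoNeighbours L v (v₁ ∷ v₂ ∷ vs) v (v-v₁ , chain) unique v∉ v∉ (inj₂ 2≤) (here refl) (here refl)
        (All.tabulate there) x∈

double : ℕ → ℕ
double zero    = zero
double (suc n) = suc (suc (double n))

even-double : ∀ n → Even (double n)
even-double zero    = refl
even-double (suc n) = even-double n

odd-suc-double : ∀ n → Odd (suc (double n))
odd-suc-double zero    = refl
odd-suc-double (suc n) = odd-suc-double n

double-injective : ∀ m n → double m ≡ double n → m ≡ n
double-injective zero    zero    _  = refl
double-injective (suc m) (suc n) eq = cong suc (double-injective m n (suc-injective (suc-injective eq)))

even⇒¬odd : ∀ n → Even n → ¬ Odd n
even⇒¬odd n ev od with trans (sym ev) od
... | ()

module _ {A : Game} {f : M A → Maybe (M A)} where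

  σ-reply⁻ : ∀ {q} → σ[ A , f ] q → ∀ s {a b} → q ≡ s ∷ʳ a ∷ʳ b → Odd (length (s ∷ʳ a)) →
             f a ≡ just b × P A (s ∷ʳ a ∷ʳ b)
  σ-reply⁻ nil s eq _ = ⊥-elim (∷ʳ≢[] (s ∷ʳ _) (sym eq))
  σ-reply⁻ (omove {t} _ ev _ _) s eq od with ∷ʳ-injective t (s ∷ʳ _) eq
  ... | refl , _ = ⊥-elim (even⇒¬odd (length t) ev od)
  σ-reply⁻ (pmove {t} {a} _ _ fa p) s eq _ with ∷ʳ-injective (t ∷ʳ a) (s ∷ʳ _) eq
  ... | eq′ , refl with ∷ʳ-injective t s eq′
  ... | refl , refl = fa , p

module ScriptedOpponent (A : Game) (P-[] : P A []) (o : ℕ → M A) (o-O : ∀ i → lab A (o i) ≡ Opp) where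

  data Scripted : List (M A) → Set where
    []    : Scripted []
    opens : ∀ {s} i → Scripted s → length s ≡ double i → P A (s ∷ʳ o i) → Scripted (s ∷ʳ o i)
    reply : ∀ {s x} → Scripted s → Odd (length s) → P A (s ∷ʳ x) → Scripted (s ∷ʳ x)

  private
    init : ∀ {q} → Scripted q → ∀ s {x} → q ≡ s ∷ʳ x → Scripted s
    init []                    s eq = ⊥-elim (∷ʳ≢[] s (sym eq))
    init (opens {t} _ τt _ _)  s eq with ∷ʳ-injective t s eq
    ... | refl , _ = τt
    init (reply {t} τt _ _)    s eq with ∷ʳ-injective t s eq
    ... | refl , _ = τt

    prefix : ∀ s t → Scripted (s ++ t) → Scripted s
    prefix s []      τs = subst Scripted (++-identityʳ s) τs
    prefix s (x ∷ t) τs = init (prefix (s ∷ʳ x) t (subst Scripted (sym (++-assoc s (x ∷ []) t)) τs)) s refl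

    positions : ∀ s → Scripted s → P A s
    positions _ []              = P-[]
    positions _ (opens _ _ _ p) = p
    positions _ (reply _ _ p)   = p

    first-O : ∀ {q} → Scripted q → ∀ a s → q ≡ a ∷ s → lab A a ≡ Opp
    first-O (opens {[]} i _ _ _)    _ _ refl = o-O i
    first-O (opens {b ∷ t} _ τ _ _) _ _ refl = first-O τ b t refl
    first-O (reply {[]} _ () _)     _ _ refl
    first-O (reply {b ∷ t} τ _ _)   _ _ refl = first-O τ b t refl

    last-even : ∀ {q} → Scripted q → ∀ s {x} → q ≡ s ∷ʳ x → Even (length s) →
                ∃ λ i → length s ≡ double i × x ≡ o i
    last-even []                    s eq _  = ⊥-elim (∷ʳ≢[] s (sym eq))
    last-even (opens {t} i _ len _) s eq _  with ∷ʳ-injective t s eq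
    ... | refl , refl = i , len , refl
    last-even (reply {t} _ od _)    s eq ev with ∷ʳ-injective t s eq
    ... | refl , _ = ⊥-elim (even⇒¬odd (length s) ev od)

    deterministic : ∀ s a b → Even (length s) → Scripted (s ∷ʳ a) → Scripted (s ∷ʳ b) → a ≡ b
    deterministic s a b ev τa τb
      with last-even τa s refl ev | last-even τb s refl ev
    ... | i , len-i , refl | j , len-j , refl
      with double-injective i j (trans (sym len-i) len-j)
    ... | refl = refl

  isCounterStrategy : IsCounterStrategy A Scripted
  isCounterStrategy = record
    { nonempty   = []
    ; prefix     = prefix
    ; positions  = positions
    ; O-start    = λ a s τ → first-O τ a s refl
    ; det-even   = deterministic
    ; closed-odd = λ s a od τ p → reply τ od p
    }

rounds : (o r : ℕ → X) → ℕ → List X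
rounds o r zero    = []
rounds o r (suc i) = rounds o r i ∷ʳ o i ∷ʳ r i

length-rounds : (o r : ℕ → X) → ∀ i → length (rounds o r i) ≡ double i
length-rounds o r zero    = refl
length-rounds o r (suc i) =
  trans (length-∷ʳ (rounds o r i ∷ʳ o i) (r i))
        (cong suc (trans (length-∷ʳ (rounds o r i) (o i)) (cong suc (length-rounds o r i))))

rounds-∈ : (o r : ℕ → X) → ∀ {i n} → i ≤ n → o i ∈ rounds o r n ∷ʳ o n
rounds-∈ o r {n = zero} z≤n = here refl
rounds-∈ o r {i} {suc n} i≤ with m≤n⇒m<n∨m≡n i≤
... | inj₁ i<1+n = ∈-++⁺ˡ (∈-++⁺ˡ (rounds-∈ o r (≤-pred i<1+n)))
... | inj₂ refl  = ∈-++⁺ʳ _ (here refl)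

σ-loses-to-script : (A : Game) → P A [] → (f : M A → Maybe (M A)) (o r : ℕ → M A) →
  (∀ i → lab A (o i) ≡ Opp) → (∀ i → f (o i) ≡ just (r i)) →
  ∀ n → (∀ i → i ≤ n → P A (rounds o r i ∷ʳ o i)) → (∀ i → i < n → P A (rounds o r (suc i))) →
  ¬ P A (rounds o r n ∷ʳ o n ∷ʳ r n) → ¬ Winning A σ[ A , f ]
σ-loses-to-script A P-[] f o r o-O f-o n opened replied illegal win =
  even⇒¬odd (length (position n))
    (proj₁ (win Scripted isCounterStrategy) (position n) (proj₁ (reached n ≤-refl)) (proj₂ (reached n ≤-refl))
           stuck)
    (odd-position n)
  where
  open ScriptedOpponent A P-[] o o-O

  position : ℕ → List (M A)
  position i = rounds o r i ∷ʳ o i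

  odd-position : ∀ i → Odd (length (position i))
  odd-position i =
    subst Odd (sym (trans (length-∷ʳ (rounds o r i) (o i)) (cong suc (length-rounds o r i)))) (odd-suc-double i)

  reached : ∀ i → i ≤ n → σ[ A , f ] (position i) × Scripted (position i)
  reached zero    _   = omove nil refl (o-O 0) (opened 0 z≤n) , opens 0 [] refl (opened 0 z≤n)
  reached (suc i) i<n with reached i (<⇒≤ i<n)
  ... | σi , τi =
    omove (pmove σi (odd-position i) (f-o i) (replied i i<n)) even (o-O (suc i)) (opened (suc i) i<n) ,
    opens (suc i) (reply τi (odd-position i) (replied i i<n)) (length-rounds o r (suc i)) (opened (suc i) i<n)
    where
    even : Even (length (rounds o r (suc i)))
    even = subst Even (sym (length-rounds o r (suc i))) (even-double (suc i))

  stuck : ∀ c → σ[ A , f ] (position n ∷ʳ c) → Scripted (position n ∷ʳ c) → ⊥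
  stuck c σc _ with σ-reply⁻ σc (rounds o r n) refl (odd-position n)
  ... | fc , legal with just-injective (trans (sym (f-o n)) fc)
  ... | refl = illegal legal

EndsWith : (G : Game) → Pol → List (M G) → Set
EndsWith G p = OnLast (λ z → lab G z ≡ p)

⊗-shape-∷ʳ² : (l : X ⊎ Y → Pol) (r : List (X ⊎ Y)) {z w : X ⊎ Y} →
  Alternating l r → SwitchO l r → OnLast (λ v → l v ≡ Pla) r →
  l z ≡ Opp → l w ≡ Pla → ¬ DiffComp z w →
  (Alternating l (r ∷ʳ z) × SwitchO l (r ∷ʳ z))
  × (Alternating l (r ∷ʳ z ∷ʳ w) × SwitchO l (r ∷ʳ z ∷ʳ w))
⊗-shape-∷ʳ² l r {z} {w} alt sw last lz lw same = (alt₁ , sw₁) , (alt₂ , sw₂)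
  where
  alt₁ : Alternating l (r ∷ʳ z)
  alt₁ = Alternating-∷ʳ l r alt
           (OnLast-map (λ lv≡Pla lv≡lz → Pla≢Opp (trans (sym lv≡Pla) (trans lv≡lz lz))) r last)
  sw₁ : SwitchO l (r ∷ʳ z)
  sw₁ = SwitchO-∷ʳ l r sw (OnLast-universal (λ _ _ → lz) r)
  alt₂ : Alternating l (r ∷ʳ z ∷ʳ w)
  alt₂ = Alternating-∷ʳ l (r ∷ʳ z) alt₁
           (OnLast-∷ʳ r (λ lz≡lw → Pla≢Opp (trans (sym lw) (trans (sym lz≡lw) lz))))
  sw₂ : SwitchO l (r ∷ʳ z ∷ʳ w)
  sw₂ = SwitchO-∷ʳ l (r ∷ʳ z) sw₁ (OnLast-∷ʳ r (λ d → ⊥-elim (same d)))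

⅋-extendˡ : (A B : Game) (r : List (M (A ⅋ B))) {x y : M A} →
  P (A ⅋ B) r → EndsWith ((A ^⊥) ⊗ (B ^⊥)) Pla r → lab A x ≡ Pla → lab A y ≡ Opp →
  P A (projL r ∷ʳ x) → P A (projL r ∷ʳ x ∷ʳ y) →
  P (A ⅋ B) (r ∷ʳ inj₁ x) × P (A ⅋ B) (r ∷ʳ inj₁ x ∷ʳ inj₁ y)
⅋-extendˡ A B r {x} {y} (alt , _ , pr , sw) last x-P y-O px pxy
  with ⊗-shape-∷ʳ² (lab ((A ^⊥) ⊗ (B ^⊥))) r alt sw last (cong flipPol x-P) (cong flipPol y-O) (λ ())
... | (alt₁ , sw₁) , (alt₂ , sw₂) =
  (alt₁ , subst (P A) (sym (projL-∷ʳ₁ r x)) px , subst (P B) (sym (projR-∷ʳ₁ r x)) pr , sw₁) ,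
  (alt₂ , subst (P A) (sym (projL-∷ʳ₁₁ r x y)) pxy , subst (P B) (sym (projR-∷ʳ₁₁ r x y)) pr , sw₂)

⅋-extendʳ : (A B : Game) (r : List (M (A ⅋ B))) {x y : M B} →
  P (A ⅋ B) r → EndsWith ((A ^⊥) ⊗ (B ^⊥)) Pla r → lab B x ≡ Pla → lab B y ≡ Opp →
  P B (projR r ∷ʳ x) → P B (projR r ∷ʳ x ∷ʳ y) →
  P (A ⅋ B) (r ∷ʳ inj₂ x) × P (A ⅋ B) (r ∷ʳ inj₂ x ∷ʳ inj₂ y)
⅋-extendʳ A B r {x} {y} (alt , pl , _ , sw) last x-P y-O px pxy
  with ⊗-shape-∷ʳ² (lab ((A ^⊥) ⊗ (B ^⊥))) r alt sw last (cong flipPol x-P) (cong flipPol y-O) (λ ())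
... | (alt₁ , sw₁) , (alt₂ , sw₂) =
  (alt₁ , subst (P A) (sym (projL-∷ʳ₂ r x)) pl , subst (P B) (sym (projR-∷ʳ₂ r x)) px , sw₁) ,
  (alt₂ , subst (P A) (sym (projL-∷ʳ₂₂ r x y)) pl , subst (P B) (sym (projR-∷ʳ₂₂ r x y)) pxy , sw₂)

module _ {k : ℕ} (A : Fin k → Game) where

  lab-injF : ∀ (F : Formula k) (o : Occ F) a → lab (⟦_⟧F A F) (injF A o a) ≡ lab (litGame A (litOf o)) a
  lab-injF (lit l)        (here l)  a = refl
  lab-injF (bin tens F G) (left o)  a = lab-injF F o a
  lab-injF (bin par F G)  (left o)  a = trans (flipPol-involutive _) (lab-injF F o a)
  lab-injF (bin tens F G) (right o) a = lab-injF G o a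
  lab-injF (bin par F G)  (right o) a = trans (flipPol-involutive _) (lab-injF G o a)

  lab-injS : ∀ (Γ : Sequent k) (o : SOcc Γ) a → lab (⟦_⟧S A Γ) (injS A o a) ≡ lab (litGame A (litS o)) a
  lab-injS (F ∷ [])    (hd o) a = lab-injF F o a
  lab-injS (F ∷ G ∷ Γ) (hd o) a = trans (flipPol-involutive _) (lab-injF F o a)
  lab-injS (F ∷ G ∷ Γ) (tl o) a = trans (flipPol-involutive _) (lab-injS (G ∷ Γ) o a)

oneMove : Game
M   oneMove   = Pol
lab oneMove p = p
P   oneMove s = length s ≤ 1
W   oneMove _ = ⊥

oneMove-isGame : IsGame oneMove
oneMove-isGame = record
  { P-nonempty    = z≤n
  ; P-prefix      = prefix
  ; P-alternating = alternating
  ; W-plays       = λ _ ()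
  }
  where
  prefix : ∀ s t → length (s ++ t) ≤ 1 → length s ≤ 1
  prefix []          t _ = z≤n
  prefix (x ∷ [])    t _ = s≤s z≤n
  prefix (x ∷ y ∷ s) t (s≤s ())
  alternating : ∀ s → length s ≤ 1 → Alternating (λ p → p) s
  alternating []          _ = tt
  alternating (x ∷ [])    _ = tt
  alternating (x ∷ y ∷ s) (s≤s ())

module _ {k : ℕ} where

  oneMoves : Fin k → Game
  oneMoves _ = oneMove

  atomG : Lit k → Game
  atomG = litGame oneMoves

  formG : Formula k → Game
  formG = ⟦_⟧F oneMoves

  seqG : Sequent k → Game
  seqG = ⟦_⟧S oneMoves

  atom-short : ∀ (l : Lit k) s → P (atomG l) s → length s ≤ 1
  atom-short (pos j) s p = p
  atom-short (neg j) s p = p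

  atom-single : ∀ (l : Lit k) a → P (atomG l) (a ∷ [])
  atom-single (pos j) a = s≤s z≤n
  atom-single (neg j) a = s≤s z≤n

  oMove : (l : Lit k) → M (atomG l)
  oMove (pos j) = Opp
  oMove (neg j) = Pla

  lab-oMove : ∀ (l : Lit k) → lab (atomG l) (oMove l) ≡ Opp
  lab-oMove (pos j) = refl
  lab-oMove (neg j) = refl

  lab-dualMove : ∀ (l : Lit k) l' (eq : l' ≡ dualLit l) →
    lab (atomG l') (dualMove oneMoves l l' eq (oMove l)) ≡ Pla
  lab-dualMove (pos j) .(neg j) refl = refl
  lab-dualMove (neg j) .(pos j) refl = refl

  []-legalF : ∀ (F : Formula k) → P (formG F) []
  []-legalF (lit (pos j))  = z≤n
  []-legalF (lit (neg j))  = z≤n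
  []-legalF (bin tens F G) = tt , []-legalF F , []-legalF G , tt
  []-legalF (bin par F G)  = tt , []-legalF F , []-legalF G , tt

  []-legalS : ∀ (Γ : Sequent k) → P (seqG Γ) []
  []-legalS []          = refl
  []-legalS (F ∷ [])    = []-legalF F
  []-legalS (F ∷ G ∷ Γ) = tt , []-legalF F , []-legalS (G ∷ Γ) , tt

  single-legalF : ∀ (F : Formula k) (o : Occ F) a → P (formG F) (injF oneMoves o a ∷ [])
  single-legalF (lit l)        (here l)  a = atom-single l a
  single-legalF (bin tens F G) (left o)  a = tt , single-legalF F o a , []-legalF G , tt
  single-legalF (bin par F G)  (left o)  a = tt , single-legalF F o a , []-legalF G , tt
  single-legalF (bin tens F G) (right o) a = tt , []-legalF F , single-legalF G o a , tt
  single-legalF (bin par F G)  (right o) a = tt , []-legalF F , single-legalF G o a , tt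

  tensor-switch-legal : ∀ (l l' : Lit k) (a : M (atomG l)) (b : M (atomG l')) →
    lab (atomG l) a ≡ Pla → lab (atomG l') b ≡ Opp →
    P (formG (bin tens (lit l) (lit l'))) (inj₁ a ∷ inj₂ b ∷ [])
    × P (formG (bin tens (lit l') (lit l))) (inj₂ a ∷ inj₁ b ∷ [])
  tensor-switch-legal l l' a b a-P b-O =
    (alternates , atom-single l a , atom-single l' b , (λ _ → b-O) , tt) ,
    (alternates , atom-single l' b , atom-single l a , (λ _ → b-O) , tt)
    where
    alternates : lab (atomG l) a ≢ lab (atomG l') b × ⊤
    alternates = (λ eq → Pla≢Opp (trans (sym a-P) (trans eq b-O))) , tt

  -- A second move in a one-move atom is illegal, and inside a tensor only Opponent may switch.
  simple-noLatePlayerMove : ∀ {F : Formula k} → IsSimpleFormula F → ∀ t y x →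
    P (formG F) (t ∷ʳ y ∷ʳ x) → lab (formG F) x ≢ Pla
  simple-noLatePlayerMove (isLit l) t y x p _ = ∷ʳ²-long t y x (atom-short l _ p)
  simple-noLatePlayerMove (isTens l l') t (inj₁ y) (inj₁ x) (_ , pl , _ , _) _ =
    ∷ʳ²-long (projL t) y x (atom-short l _ (subst (P (atomG l)) (projL-∷ʳ₁₁ t y x) pl))
  simple-noLatePlayerMove (isTens l l') t (inj₂ y) (inj₂ x) (_ , _ , pr , _) _ =
    ∷ʳ²-long (projR t) y x (atom-short l' _ (subst (P (atomG l')) (projR-∷ʳ₂₂ t y x) pr))
  simple-noLatePlayerMove (isTens l l') t (inj₁ y) (inj₂ x) (_ , _ , _ , sw) x-P =
    Pla≢Opp (trans (sym x-P) (SwitchO-∷ʳ⁻ _ t sw tt))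
  simple-noLatePlayerMove (isTens l l') t (inj₂ y) (inj₁ x) (_ , _ , _ , sw) x-P =
    Pla≢Opp (trans (sym x-P) (SwitchO-∷ʳ⁻ _ t sw tt))
module _ {k : ℕ} where

  formulaIndex : {Γ : Sequent k} → SOcc Γ → Fin (length Γ)
  formulaIndex (hd _) = Fin.zero
  formulaIndex (tl o) = Fin.suc (formulaIndex o)

  moveFormula : ∀ (Γ : Sequent k) → M (seqG Γ) → Fin (length Γ)
  moveFormula (F ∷ [])    _        = Fin.zero
  moveFormula (F ∷ G ∷ Γ) (inj₁ _) = Fin.zero
  moveFormula (F ∷ G ∷ Γ) (inj₂ z) = Fin.suc (moveFormula (G ∷ Γ) z)

  moveFormula-injS : ∀ (Γ : Sequent k) (o : SOcc Γ) a → moveFormula Γ (injS oneMoves o a) ≡ formulaIndex o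
  moveFormula-injS (F ∷ [])    (hd o) a = refl
  moveFormula-injS (F ∷ G ∷ Γ) (hd o) a = refl
  moveFormula-injS (F ∷ G ∷ Γ) (tl o) a = cong Fin.suc (moveFormula-injS (G ∷ Γ) o a)

  Untouched : ∀ (Γ : Sequent k) → Fin (length Γ) → List (M (seqG Γ)) → Set
  Untouched Γ i = All (λ z → moveFormula Γ z ≢ i)

  Touched : ∀ (Γ : Sequent k) → Fin (length Γ) → List (M (seqG Γ)) → Set
  Touched Γ i = Any (λ z → moveFormula Γ z ≡ i)

  untouched-single : ∀ (F : Formula k) r → Untouched (F ∷ []) Fin.zero r → r ≡ []
  untouched-single F []      _           = refl
  untouched-single F (z ∷ r) (z≢0 ∷ _) = ⊥-elim (z≢0 refl)

  untouched-projL : ∀ (F G : Formula k) (Γ : Sequent k) r → Untouched (F ∷ G ∷ Γ) Fin.zero r → projL r ≡ []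
  untouched-projL F G Γ []           _           = refl
  untouched-projL F G Γ (inj₁ z ∷ r) (z≢0 ∷ _)   = ⊥-elim (z≢0 refl)
  untouched-projL F G Γ (inj₂ z ∷ r) (_ ∷ fresh) = untouched-projL F G Γ r fresh

  untouched-projR : ∀ (F G : Formula k) (Γ : Sequent k) i r →
    Untouched (F ∷ G ∷ Γ) (Fin.suc i) r → Untouched (G ∷ Γ) i (projR r)
  untouched-projR F G Γ i []           _           = []
  untouched-projR F G Γ i (inj₁ z ∷ r) (_ ∷ fresh) = untouched-projR F G Γ i r fresh
  untouched-projR F G Γ i (inj₂ z ∷ r) (z≢ ∷ fresh) = (z≢ ∘ cong Fin.suc) ∷ untouched-projR F G Γ i r fresh

  touched-projL : ∀ (F G : Formula k) (Γ : Sequent k) r → Touched (F ∷ G ∷ Γ) Fin.zero r → projL r ≢ []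
  touched-projL F G Γ (inj₁ z ∷ r) _          ()
  touched-projL F G Γ (inj₂ z ∷ r) (here ())
  touched-projL F G Γ (inj₂ z ∷ r) (there t) = touched-projL F G Γ r t

  touched-projR : ∀ (F G : Formula k) (Γ : Sequent k) i r →
    Touched (F ∷ G ∷ Γ) (Fin.suc i) r → Touched (G ∷ Γ) i (projR r)
  touched-projR F G Γ i (inj₁ z ∷ r) (here ())
  touched-projR F G Γ i (inj₁ z ∷ r) (there t) = touched-projR F G Γ i r t
  touched-projR F G Γ i (inj₂ z ∷ r) (here eq) = here (Finₚ.suc-injective eq)
  touched-projR F G Γ i (inj₂ z ∷ r) (there t) = there (touched-projR F G Γ i r t)

  -- An Opponent move of A ⅋ B is a Player move of A^⊥ ⊗ B^⊥; the invariant asks for one last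
  -- at every ⅋ of the spine F ⅋ (G ⅋ …).
  EndsWithO : ∀ (Γ : Sequent k) → List (M (seqG Γ)) → Set
  EndsWithO []          r = ⊤
  EndsWithO (F ∷ [])    r = ⊤
  EndsWithO (F ∷ G ∷ Γ) r = EndsWith ((formG F ^⊥) ⊗ (seqG (G ∷ Γ) ^⊥)) Pla r × EndsWithO (G ∷ Γ) (projR r)

  []-EndsWithO : ∀ (Γ : Sequent k) → EndsWithO Γ []
  []-EndsWithO []          = tt
  []-EndsWithO (F ∷ [])    = tt
  []-EndsWithO (F ∷ G ∷ Γ) = tt , []-EndsWithO (G ∷ Γ)

  opening-legal : ∀ (Γ : Sequent k) (o : SOcc Γ) a → lab (atomG (litS o)) a ≡ Opp →
    P (seqG Γ) (injS oneMoves o a ∷ []) × EndsWithO Γ (injS oneMoves o a ∷ [])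
  opening-legal (F ∷ [])    (hd o) a a-O = single-legalF F o a , tt
  opening-legal (F ∷ G ∷ Γ) (hd o) a a-O =
    (tt , single-legalF F o a , []-legalS (G ∷ Γ) , tt) ,
    cong flipPol (trans (lab-injF oneMoves F o a) a-O) , []-EndsWithO (G ∷ Γ)
  opening-legal (F ∷ G ∷ Γ) (tl o) a a-O with opening-legal (G ∷ Γ) o a a-O
  ... | legal , ends =
    (tt , []-legalF F , legal , tt) , cong flipPol (trans (lab-injS oneMoves (G ∷ Γ) o a) a-O) , ends

  revisit-illegal : ∀ (Γ : Sequent k) → Simple Γ →
    (w : SOcc Γ) (r : List (M (seqG Γ))) (a : M (atomG (litS w))) →
    Touched Γ (formulaIndex w) r → lab (atomG (litS w)) a ≡ Pla → ¬ P (seqG Γ) (r ∷ʳ injS oneMoves w a)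
  revisit-illegal (F ∷ []) (simpleF ∷ _) (hd w) r a seen a-P p
    with nonempty⇒∷ʳ r (any⇒≢[] seen)
  ... | t , y , refl = simple-noLatePlayerMove simpleF t y _ p (trans (lab-injF oneMoves F w a) a-P)
  revisit-illegal (F ∷ G ∷ Γ) (simpleF ∷ _) (hd w) r a seen a-P (_ , pl , _ , _)
    with nonempty⇒∷ʳ (projL r) (touched-projL F G Γ r seen)
  ... | t , y , eq = simple-noLatePlayerMove simpleF t y _
          (subst (P (formG F)) (trans (projL-∷ʳ₁ r _) (cong (_∷ʳ injF oneMoves w a) eq)) pl)
          (trans (lab-injF oneMoves F w a) a-P)
  revisit-illegal (F ∷ G ∷ Γ) (_ ∷ simpleΓ) (tl w) r a seen a-P (_ , _ , pr , _) =
    revisit-illegal (G ∷ Γ) simpleΓ w (projR r) a (touched-projR F G Γ (formulaIndex w) r seen) a-P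
      (subst (P (seqG (G ∷ Γ))) (projR-∷ʳ₂ r _) pr)

  spine-extendˡ : ∀ (F G : Formula k) (Γ : Sequent k) r {x y : M (formG F)} →
    P (seqG (F ∷ G ∷ Γ)) r → EndsWithO (F ∷ G ∷ Γ) r → lab (formG F) x ≡ Pla → lab (formG F) y ≡ Opp →
    P (formG F) (projL r ∷ʳ x) → P (formG F) (projL r ∷ʳ x ∷ʳ y) →
    P (seqG (F ∷ G ∷ Γ)) (r ∷ʳ inj₁ x) × P (seqG (F ∷ G ∷ Γ)) (r ∷ʳ inj₁ x ∷ʳ inj₁ y)
    × EndsWithO (F ∷ G ∷ Γ) (r ∷ʳ inj₁ x ∷ʳ inj₁ y)
  spine-extendˡ F G Γ r {x} {y} legal (ends , endsΓ) x-P y-O px pxy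
    with ⅋-extendˡ (formG F) (seqG (G ∷ Γ)) r legal ends x-P y-O px pxy
  ... | legal₁ , legal₂ =
    legal₁ , legal₂ , OnLast-∷ʳ (r ∷ʳ inj₁ x) (cong flipPol y-O) ,
    subst (EndsWithO (G ∷ Γ)) (sym (projR-∷ʳ₁₁ r x y)) endsΓ

  spine-extendʳ : ∀ (F G : Formula k) (Γ : Sequent k) r {x y : M (seqG (G ∷ Γ))} →
    P (seqG (F ∷ G ∷ Γ)) r → EndsWithO (F ∷ G ∷ Γ) r → lab (seqG (G ∷ Γ)) x ≡ Pla → lab (seqG (G ∷ Γ)) y ≡ Opp →
    P (seqG (G ∷ Γ)) (projR r ∷ʳ x) → P (seqG (G ∷ Γ)) (projR r ∷ʳ x ∷ʳ y) →
    EndsWithO (G ∷ Γ) (projR r ∷ʳ x ∷ʳ y) →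
    P (seqG (F ∷ G ∷ Γ)) (r ∷ʳ inj₂ x) × P (seqG (F ∷ G ∷ Γ)) (r ∷ʳ inj₂ x ∷ʳ inj₂ y)
    × EndsWithO (F ∷ G ∷ Γ) (r ∷ʳ inj₂ x ∷ʳ inj₂ y)
  spine-extendʳ F G Γ r {x} {y} legal (ends , _) x-P y-O px pxy endsΓ
    with ⅋-extendʳ (formG F) (seqG (G ∷ Γ)) r legal ends x-P y-O px pxy
  ... | legal₁ , legal₂ =
    legal₁ , legal₂ , OnLast-∷ʳ (r ∷ʳ inj₂ x) (cong flipPol y-O) ,
    subst (EndsWithO (G ∷ Γ)) (sym (projR-∷ʳ₂₂ r x y)) endsΓ

  data TensorLeaf : {Γ : Sequent k} → SOcc Γ → Set where
    leftLeaf  : ∀ {l l' Γ} → TensorLeaf {bin tens (lit l) (lit l') ∷ Γ} (hd (left (here l)))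
    rightLeaf : ∀ {l l' Γ} → TensorLeaf {bin tens (lit l) (lit l') ∷ Γ} (hd (right (here l')))
    later     : ∀ {F Γ o} → TensorLeaf {Γ} o → TensorLeaf {F ∷ Γ} (tl o)

  sibling : {Γ : Sequent k} {p : SOcc Γ} → TensorLeaf p → SOcc Γ
  sibling (leftLeaf {l' = l'}) = hd (right (here l'))
  sibling (rightLeaf {l = l})  = hd (left (here l))
  sibling (later t)            = tl (sibling t)

  formulaIndex-sibling : {Γ : Sequent k} {p : SOcc Γ} (t : TensorLeaf p) →
    formulaIndex (sibling t) ≡ formulaIndex p
  formulaIndex-sibling leftLeaf  = refl
  formulaIndex-sibling rightLeaf = refl
  formulaIndex-sibling (later t) = cong Fin.suc (formulaIndex-sibling t)

  round-legal : ∀ {Γ : Sequent k} {p : SOcc Γ} (t : TensorLeaf p) (r : List (M (seqG Γ)))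
    {a : M (atomG (litS p))} {b : M (atomG (litS (sibling t)))} →
    lab (atomG (litS p)) a ≡ Pla → lab (atomG (litS (sibling t))) b ≡ Opp →
    P (seqG Γ) r → EndsWithO Γ r → Untouched Γ (formulaIndex p) r →
    let x = injS oneMoves p a ; y = injS oneMoves (sibling t) b in
    P (seqG Γ) (r ∷ʳ x) × P (seqG Γ) (r ∷ʳ x ∷ʳ y) × EndsWithO Γ (r ∷ʳ x ∷ʳ y)
  round-legal {T ∷ []} (leftLeaf {l} {l'}) r {a} {b} a-P b-O _ _ fresh
    with untouched-single T r fresh
  ... | refl = single-legalF T (left (here l)) a , proj₁ (tensor-switch-legal l l' a b a-P b-O) , tt
  round-legal {T ∷ []} (rightLeaf {l} {l'}) r {a} {b} a-P b-O _ _ fresh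
    with untouched-single T r fresh
  ... | refl = single-legalF T (right (here l')) a , proj₂ (tensor-switch-legal l' l a b a-P b-O) , tt
  round-legal {T ∷ G ∷ Γ} (leftLeaf {l} {l'}) r {a} {b} a-P b-O legal ends fresh =
    spine-extendˡ T G Γ r legal ends a-P b-O
      (subst (λ q → P (formG T) (q ∷ʳ inj₁ a)) (sym noMoveYet) (single-legalF T (left (here l)) a))
      (subst (λ q → P (formG T) (q ∷ʳ inj₁ a ∷ʳ inj₂ b)) (sym noMoveYet)
             (proj₁ (tensor-switch-legal l l' a b a-P b-O)))
    where
    noMoveYet : projL r ≡ []
    noMoveYet = untouched-projL T G Γ r fresh
  round-legal {T ∷ G ∷ Γ} (rightLeaf {l} {l'}) r {a} {b} a-P b-O legal ends fresh =
    spine-extendˡ T G Γ r legal ends a-P b-O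
      (subst (λ q → P (formG T) (q ∷ʳ inj₂ a)) (sym noMoveYet) (single-legalF T (right (here l')) a))
      (subst (λ q → P (formG T) (q ∷ʳ inj₂ a ∷ʳ inj₁ b)) (sym noMoveYet)
             (proj₂ (tensor-switch-legal l' l a b a-P b-O)))
    where
    noMoveYet : projL r ≡ []
    noMoveYet = untouched-projL T G Γ r fresh
  round-legal {F ∷ []} (later ())
  round-legal {F ∷ G ∷ Γ} {tl p} (later t) r {a} {b} a-P b-O legal@(_ , _ , pr , _) ends@(_ , endsΓ) fresh
    with round-legal t (projR r) a-P b-O pr endsΓ (untouched-projR F G Γ (formulaIndex p) r fresh)
  ... | legal₁ , legal₂ , ends′ =
    spine-extendʳ F G Γ r legal ends (trans (lab-injS oneMoves (G ∷ Γ) p a) a-P)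
      (trans (lab-injS oneMoves (G ∷ Γ) (sibling t) b) b-O) legal₁ legal₂ ends′

module _ {k : ℕ} where

  formulaRoot : {Γ : Sequent k} → SOcc Γ → SNode Γ
  formulaRoot (hd o) = hd root
  formulaRoot (tl o) = tl (formulaRoot o)

  private
    hd-injective : ∀ {F : Formula k} {Γ} {u v : Node F} → SNode.hd {Γ = Γ} u ≡ hd v → u ≡ v
    hd-injective refl = refl

    tl-injective : ∀ {F : Formula k} {Γ} {u v : SNode Γ} → SNode.tl {F = F} u ≡ tl v → u ≡ v
    tl-injective refl = refl

    left-injective : ∀ {c} {A B : Formula k} {u v : Node A} → Node.left {c = c} {B = B} u ≡ left v → u ≡ v
    left-injective refl = refl

    right-injective : ∀ {c} {A B : Formula k} {u v : Node B} → Node.right {c = c} {A = A} u ≡ right v → u ≡ v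
    right-injective refl = refl

  occNode-injective : {F : Formula k} (o o' : Occ F) → occNode o ≡ occNode o' → o ≡ o'
  occNode-injective (here l)  (here .l)  _  = refl
  occNode-injective (left o)  (left o')  eq = cong left (occNode-injective o o' (left-injective eq))
  occNode-injective (right o) (right o') eq = cong right (occNode-injective o o' (right-injective eq))
  occNode-injective (left o)  (right o') ()
  occNode-injective (right o) (left o')  ()

  leafS-injective : {Γ : Sequent k} (o o' : SOcc Γ) → leafS o ≡ leafS o' → o ≡ o'
  leafS-injective (hd o) (hd o') eq = cong hd (occNode-injective o o' (hd-injective eq))
  leafS-injective (tl o) (tl o') eq = cong tl (leafS-injective o o' (tl-injective eq))
  leafS-injective (hd o) (tl o') ()
  leafS-injective (tl o) (hd o') ()

  leaf-childless : {Γ : Sequent k} → Simple Γ → (o : SOcc Γ) → ∀ {y} → ¬ STreeEdge (leafS o) y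
  leaf-childless (isLit l ∷ _)     (hd (here .l))          (hd ())
  leaf-childless (isTens l l' ∷ _) (hd (left (here .l)))   (hd (inLeft ()))
  leaf-childless (isTens l l' ∷ _) (hd (right (here .l'))) (hd (inRight ()))
  leaf-childless (_ ∷ simple)      (tl o)                  (tl e) = leaf-childless simple o e

  leaf-parent : {Γ : Sequent k} → Simple Γ → (o : SOcc Γ) → ∀ {y} → STreeEdge y (leafS o) →
    TensorLeaf o × y ≡ formulaRoot o
  leaf-parent (isLit l ∷ _)     (hd (here .l))          (hd ())
  leaf-parent (isTens l l' ∷ _) (hd (left (here .l)))   (hd toLeft)      = leftLeaf , refl
  leaf-parent (isTens l l' ∷ _) (hd (left (here .l)))   (hd (inLeft ()))
  leaf-parent (isTens l l' ∷ _) (hd (right (here .l'))) (hd toRight)     = rightLeaf , refl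
  leaf-parent (isTens l l' ∷ _) (hd (right (here .l'))) (hd (inRight ()))
  leaf-parent (_ ∷ simple)      (tl o)                  (tl e) with leaf-parent simple o e
  ... | t , refl = later t , refl

  node-cases : {Γ : Sequent k} → Simple Γ → (x : SNode Γ) →
    (∃ λ o → x ≡ leafS o) ⊎ (∃ λ p → TensorLeaf p × x ≡ formulaRoot p)
  node-cases (isLit l ∷ _)     (hd root)         = inj₁ (hd (here l) , refl)
  node-cases (isTens l l' ∷ _) (hd root)         = inj₂ (hd (left (here l)) , leftLeaf , refl)
  node-cases (isTens l l' ∷ _) (hd (left root))  = inj₁ (hd (left (here l)) , refl)
  node-cases (isTens l l' ∷ _) (hd (right root)) = inj₁ (hd (right (here l')) , refl)
  node-cases (_ ∷ simple)      (tl x) with node-cases simple x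
  ... | inj₁ (o , refl)     = inj₁ (tl o , refl)
  ... | inj₂ (p , t , refl) = inj₂ (tl p , later t , refl)

  tensorRoot-children : {Γ : Sequent k} {p : SOcc Γ} (t : TensorLeaf p) → ∀ {y} →
    STreeEdge (formulaRoot p) y → y ≡ leafS p ⊎ y ≡ leafS (sibling t)
  tensorRoot-children leftLeaf  (hd toLeft)  = inj₁ refl
  tensorRoot-children leftLeaf  (hd toRight) = inj₂ refl
  tensorRoot-children rightLeaf (hd toLeft)  = inj₂ refl
  tensorRoot-children rightLeaf (hd toRight) = inj₁ refl
  tensorRoot-children (later t) (tl e) with tensorRoot-children t e
  ... | inj₁ refl = inj₁ refl
  ... | inj₂ refl = inj₂ refl

  tensorRoot-parentless : {Γ : Sequent k} {p : SOcc Γ} → TensorLeaf p → ∀ {y} → ¬ STreeEdge y (formulaRoot p)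
  tensorRoot-parentless leftLeaf  (hd ())
  tensorRoot-parentless rightLeaf (hd ())
  tensorRoot-parentless (later t) (tl e) = tensorRoot-parentless t e

  tensorRoot≢leaf : {Γ : Sequent k} {p : SOcc Γ} → TensorLeaf p → ∀ o → formulaRoot p ≢ leafS o
  tensorRoot≢leaf leftLeaf  (hd (left o))  ()
  tensorRoot≢leaf leftLeaf  (hd (right o)) ()
  tensorRoot≢leaf leftLeaf  (tl o)         ()
  tensorRoot≢leaf rightLeaf (hd (left o))  ()
  tensorRoot≢leaf rightLeaf (hd (right o)) ()
  tensorRoot≢leaf rightLeaf (tl o)         ()
  tensorRoot≢leaf (later t) (hd o)         ()
  tensorRoot≢leaf (later t) (tl o)         eq = tensorRoot≢leaf t o (tl-injective eq)

  record AxiomTensorCircuit (Γ : Sequent k) (φ : SOcc Γ → SOcc Γ) : Set₁ where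
    field
      Member   : SOcc Γ → Set
      start    : ∃ Member
      continue : ∀ o → Member o → Σ (TensorLeaf (φ o)) λ t → Member (sibling t)

  module ProofStructure (Γ : Sequent k) (φ : SOcc Γ → SOcc Γ) (φ-involutive : ∀ o → φ (φ o) ≡ o)
                        (simple : Simple Γ) where

    Adj-sym : ∀ {x y} → Adj Γ φ x y → Adj Γ φ y x
    Adj-sym (inj₁ e)                        = inj₂ (inj₁ e)
    Adj-sym (inj₂ (inj₁ e))                 = inj₁ e
    Adj-sym (inj₂ (inj₂ (o , refl , refl))) = inj₂ (inj₂ (φ o , refl , cong leafS (sym (φ-involutive o))))

    leaf-neighbours : (o : SOcc Γ) → ∀ {y} → Adj Γ φ (leafS o) y →
      y ≡ leafS (φ o) ⊎ (TensorLeaf o × y ≡ formulaRoot o)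
    leaf-neighbours o (inj₁ e)                         = ⊥-elim (leaf-childless simple o e)
    leaf-neighbours o (inj₂ (inj₁ e))                  = inj₂ (leaf-parent simple o e)
    leaf-neighbours o (inj₂ (inj₂ (o' , eq , refl))) with leafS-injective o o' eq
    ... | refl = inj₁ refl

    tensorRoot-neighbours : {p : SOcc Γ} (t : TensorLeaf p) → ∀ {y} → Adj Γ φ (formulaRoot p) y →
      y ≡ leafS p ⊎ (⊤ × y ≡ leafS (sibling t))
    tensorRoot-neighbours t (inj₁ e) with tensorRoot-children t e
    ... | inj₁ eq = inj₁ eq
    ... | inj₂ eq = inj₂ (tt , eq)
    tensorRoot-neighbours t (inj₂ (inj₁ e))            = ⊥-elim (tensorRoot-parentless t e)
    tensorRoot-neighbours t (inj₂ (inj₂ (o , eq , _))) = ⊥-elim (tensorRoot≢leaf t o eq)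

    module OnCycle (L : List (SNode Γ)) (two : ∀ {x} → x ∈ L → TwoNeighboursIn (Adj Γ φ) L x) where

      partner-onCycle : ∀ o → leafS o ∈ L → leafS (φ o) ∈ L
      partner-onCycle o o∈ = proj₁ (twoNeighbours-among (Adj Γ φ) (two o∈) (leaf-neighbours o))

      -- The cycle reaches φ o through the axiom link, so it must leave through a tensor root.
      next-onCycle : ∀ o → leafS o ∈ L → Σ (TensorLeaf (φ o)) λ t → leafS (sibling t) ∈ L
      next-onCycle o o∈ with twoNeighbours-among (Adj Γ φ) (two (partner-onCycle o o∈)) (leaf-neighbours (φ o))
      ... | _ , t , root∈ =
        t , proj₂ (proj₂ (twoNeighbours-among (Adj Γ φ) (two root∈) (tensorRoot-neighbours t)))

      leaf-onCycle : ∀ {x} → x ∈ L → ∃ λ o → leafS o ∈ L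
      leaf-onCycle {x} x∈ with node-cases simple x
      ... | inj₁ (o , refl)     = o , x∈
      ... | inj₂ (p , t , refl) = p , proj₁ (twoNeighbours-among (Adj Γ φ) (two x∈) (tensorRoot-neighbours t))

    cycle⇒circuit : HasCycle (Adj Γ φ) → AxiomTensorCircuit Γ φ
    cycle⇒circuit cycle with cycle-twoNeighbours Adj-sym cycle
    ... | L , (_ , v∈) , two = record
      { Member   = λ o → leafS o ∈ L
      ; start    = leaf-onCycle v∈
      ; continue = next-onCycle
      }
      where open OnCycle L two

module FollowCircuit {k : ℕ} (Γ : Sequent k) (φ : SOcc Γ → SOcc Γ)
                     (dual : ∀ o → litS (φ o) ≡ dualLit (litS o))
                     (simple : Simple Γ) (circuit : AxiomTensorCircuit Γ φ) where

  open AxiomTensorCircuit circuit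

  FΓ : Game
  FΓ = F[_] oneMoves Γ

  walk : ℕ → Σ (SOcc Γ) Member
  walk zero    = start
  walk (suc n) = sibling (proj₁ next) , proj₂ next
    where
    next : Σ (TensorLeaf (φ (proj₁ (walk n)))) λ t → Member (sibling t)
    next = continue _ (proj₂ (walk n))

  u : ℕ → SOcc Γ
  u n = proj₁ (walk n)

  switch : ∀ n → TensorLeaf (φ (u n))
  switch n = proj₁ (continue _ (proj₂ (walk n)))

  opening : ℕ → SMove oneMoves Γ
  opening i = u i , oMove (litS (u i))

  copy : ℕ → SMove oneMoves Γ
  copy i = φ (u i) , dualMove oneMoves (litS (u i)) (litS (φ (u i))) (dual (u i)) (oMove (litS (u i)))

  toS : SMove oneMoves Γ → M (seqG Γ)
  toS (o , a) = injS oneMoves o a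

  lab-opening : ∀ i → lab FΓ (opening i) ≡ Opp
  lab-opening i = trans (lab-injS oneMoves Γ (u i) _) (lab-oMove (litS (u i)))

  lab-copy : ∀ i → lab (atomG (litS (φ (u i)))) (proj₂ (copy i)) ≡ Pla
  lab-copy i = lab-dualMove (litS (u i)) (litS (φ (u i))) (dual (u i))

  f-opening : ∀ i → fφ oneMoves Γ φ dual (opening i) ≡ just (copy i)
  f-opening i rewrite lab-oMove (litS (u i)) = refl

  formulaAt : ℕ → Fin (length Γ)
  formulaAt i = formulaIndex (u i)

  formulaIndex-copy : ∀ i → formulaIndex (φ (u i)) ≡ formulaAt (suc i)
  formulaIndex-copy i = sym (formulaIndex-sibling (switch i))

  position : ℕ → List (SMove oneMoves Γ)
  position i = rounds opening copy i ∷ʳ opening i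

  Visited : ℕ → List (M (seqG Γ)) → Set
  Visited i = All (λ z → ∃ λ m → m ≤ i × moveFormula Γ z ≡ formulaAt m)

  record Reached (i : ℕ) : Set where
    field
      history-legal : P FΓ (rounds opening copy i)
      legal         : P FΓ (position i)
      endsWithO     : EndsWithO Γ (map toS (position i))
      visited       : Visited i (map toS (position i))

  module _ (n : ℕ) (injective : ∀ {m} → m ≤ n → ¬ Repeats formulaAt m) where

    fresh : ∀ {i s} → suc i ≤ n → Visited i s → Untouched Γ (formulaIndex (φ (u i))) s
    fresh {i} i<n = All.map λ (m , m≤i , eq) eq′ →
      injective i<n (m , s≤s m≤i , trans (sym eq) (trans eq′ (formulaIndex-copy i)))

    reached-zero : Reached 0
    reached-zero = record
      { history-legal = []-legalS Γ
      ; legal         = proj₁ (opening-legal Γ (u 0) _ (lab-oMove (litS (u 0))))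
      ; endsWithO     = proj₂ (opening-legal Γ (u 0) _ (lab-oMove (litS (u 0))))
      ; visited       = (0 , z≤n , moveFormula-injS Γ (u 0) _) ∷ []
      }

    reached-suc : ∀ {i} → suc i ≤ n → Reached i → Reached (suc i)
    reached-suc {i} i<n reachedᵢ
      with round-legal (switch i) (map toS (position i)) (lab-copy i) (lab-oMove (litS (u (suc i))))
             (Reached.legal reachedᵢ) (Reached.endsWithO reachedᵢ) (fresh i<n (Reached.visited reachedᵢ))
    ... | legal₁ , legal₂ , ends₂ = record
      { history-legal = subst (P (seqG Γ)) (sym (map-∷ʳ toS (position i) (copy i))) legal₁
      ; legal         = subst (P (seqG Γ)) (sym extended) legal₂
      ; endsWithO     = subst (EndsWithO Γ) (sym extended) ends₂
      ; visited       = subst (Visited (suc i)) (sym extended)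
          (∷ʳ⁺ (∷ʳ⁺ (All.map (λ (m , m≤i , eq) → m , m≤n⇒m≤1+n m≤i , eq) (Reached.visited reachedᵢ))
                    (suc i , ≤-refl , trans (moveFormula-injS Γ (φ (u i)) _) (formulaIndex-copy i)))
               (suc i , ≤-refl , moveFormula-injS Γ (u (suc i)) _))
      }
      where
      extended : map toS (position (suc i)) ≡ map toS (position i) ∷ʳ toS (copy i) ∷ʳ toS (opening (suc i))
      extended = trans (map-∷ʳ toS (rounds opening copy (suc i)) (opening (suc i)))
                       (cong (_∷ʳ toS (opening (suc i))) (map-∷ʳ toS (position i) (copy i)))

    reached : ∀ i → i ≤ n → Reached i
    reached zero    _   = reached-zero
    reached (suc i) i<n = reached-suc i<n (reached i (<⇒≤ i<n))

  copy-illegal : ∀ n → Repeats formulaAt (suc n) → ¬ P FΓ (position n ∷ʳ copy n)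
  copy-illegal n (m , m<1+n , eq) legal =
    revisit-illegal Γ simple (φ (u n)) (map toS (position n)) _ touched (lab-copy n)
      (subst (P (seqG Γ)) (map-∷ʳ toS (position n) (copy n)) legal)
    where
    touched : Touched Γ (formulaIndex (φ (u n))) (map toS (position n))
    touched = lose (∈-map⁺ toS (rounds-∈ opening copy (≤-pred m<1+n)))
                   (trans (moveFormula-injS Γ (u m) _) (trans eq (sym (formulaIndex-copy n))))

  σ-loses : ¬ Winning FΓ σ[ FΓ , fφ oneMoves Γ φ dual ]
  σ-loses with firstRepetition formulaAt
  ... | n , repeats , injective =
    σ-loses-to-script FΓ ([]-legalS Γ) (fφ oneMoves Γ φ dual) opening copy lab-opening f-opening n
      (λ i i≤n → Reached.legal (reached n injective i i≤n))
      (λ i i<n → Reached.history-legal (reached n injective (suc i) i<n))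
      (copy-illegal n repeats)

proposition10 : ∀ {k : ℕ} (Γ : Sequent k) (φ : SOcc Γ → SOcc Γ) →
    Binary Γ → Simple Γ → (link : IsAxiomLinking Γ φ) →
    WinningFor Γ φ (IsAxiomLinking.dual-lits link) →
    Acyclic Γ φ
proposition10 Γ φ _ simple link win cycle =
  FollowCircuit.σ-loses Γ φ dual-lits simple (cycle⇒circuit cycle) (proj₂ (win oneMoves (λ _ → oneMove-isGame)))
  where
  open IsAxiomLinking link
  open ProofStructure Γ φ involutive simple
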